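{- Let $G$ be the complete (undirected) graph on $n\ge 1$ vertices and let $S$ be a set consisting of a single vertex. Then under the linear threshold model, $\sigma(S)<3\sqrt{n}$.
   Context: Linear threshold model on an undirected graph $G=(V,E)$: given a seed set $S\subseteq V$, every vertex $v$ with $\deg(v)>0$ independently draws a threshold $\theta_v$ uniformly at random from $\{1,\dots,\deg(v)\}$ ($\theta_v=\infty$ if $\deg(v)=0$). Initially the vertices of $S$ are infected; in each round every vertex with at least $\theta_v$ infected neighbours becomes infected, until no change occurs. $\sigma(S)$ is the expected number of infected vertices at the end. -}

module Defs where

open import Data.Bool using (Bool; true; false; _∧_; _∨_; not; if_then_else_)
open import Data.Nat as ℕ using (ℕ; zero; suc; pred; _≤?_)
open import Data.Fin as Fin using (Fin; toℕ; _≟_)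
open import Data.List using (List; map; foldr)
open import Data.List using () renaming (allFin to finList)
open import Data.Integer using (+_)
open import Data.Rational using (ℚ; 0ℚ; _+_; _*_; _/_)
open import Relation.Nullary.Decidable using (isYes)
open import Function using (_∘_)

Adj : ℕ → Set
Adj n = Fin n → Fin n → Bool

VSet : ℕ → Set
VSet n = Fin n → Bool

countℕ : ∀ {n} → (Fin n → Bool) → ℕ
countℕ {n} P = foldr (λ j acc → (if P j then 1 else 0) ℕ.+ acc) 0 (finList n)

size : ∀ {n} → VSet n → ℕ
size = countℕ

deg : ∀ {n} → Adj n → Fin n → ℕ
deg G v = countℕ (G v)

complete : (n : ℕ) → Adj n
complete n i j = not (isYes (i ≟ j))

single : ∀ {n} → Fin n → VSet n
single s v = isYes (s ≟ v)

-- A threshold assignment: for each v, an index a_v : Fin (max 1 (deg v)),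
-- standing for θ_v = a_v + 1 ∈ {1,…,deg v} when deg v > 0.
-- When deg v = 0 there is exactly one (dummy) choice and θ_v = ∞ (see step).
Range : ∀ {n} → Adj n → Fin n → ℕ
Range G v = pred (deg G v)

Thresholds : ∀ {n} → Adj n → Set
Thresholds {n} G = (v : Fin n) → Fin (suc (Range G v))

infNbrs : ∀ {n} → Adj n → VSet n → Fin n → ℕ
infNbrs G I v = countℕ (λ j → G v j ∧ I j)

step : ∀ {n} (G : Adj n) → Thresholds G → VSet n → VSet n
step G θ I v =
  I v ∨ (isYes (1 ≤? deg G v) ∧ isYes (suc (toℕ (θ v)) ≤? infNbrs G I v))

iter : ∀ {A : Set} → ℕ → (A → A) → A → A
iter zero f x = x
iter (suc k) f x = f (iter k f x)

-- final infected set: the process is monotone on n vertices, hence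
-- stabilises after at most n rounds; n rounds reach the fixed point.
final : ∀ {n} (G : Adj n) → Thresholds G → VSet n → VSet n
final {n} G θ S = iter n (step G θ) S

-- Expectation of f over independent uniform choices a_v ∈ Fin (suc (m v)).
sumℚ : List ℚ → ℚ
sumℚ = foldr _+_ 0ℚ

consF : ∀ {n} {m : Fin (suc n) → ℕ} → Fin (suc (m Fin.zero)) →
        ((v : Fin n) → Fin (suc (m (Fin.suc v)))) → (v : Fin (suc n)) → Fin (suc (m v))
consF a g Fin.zero = a
consF a g (Fin.suc v) = g v

expect : (n : ℕ) (m : Fin n → ℕ) → (((v : Fin n) → Fin (suc (m v))) → ℚ) → ℚ
expect zero m f = f (λ ())
expect (suc n) m f =
  sumℚ (map (λ a → expect n (m ∘ Fin.suc) (λ g → f (consF {m = m} a g)))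
            (finList (suc (m Fin.zero))))
  * (+ 1 / suc (m Fin.zero))

σ : ∀ {n} → Adj n → VSet n → ℚ
σ {n} G S = expect n (Range G) (λ θ → + size (final G θ S) / 1)

-- On the complete graph a vertex becomes infected as soon as the number of infected vertices
-- reaches its threshold, so the process infects at most F vertices, where F is the least k ≥ 1
-- such that fewer than k of the non-seed vertices have threshold ≤ k; then F = 1 + #{v : θ_v ≤ F}.
-- Whether θ_v ≤ F does not change when v is dropped from the candidates, and the cascade of the
-- remaining candidates does not depend on θ_v. Hence the expected cascade g(a) of a candidates with
-- thresholds uniform on {1, …, n − 1} satisfies g(a + 1) = 1 + (a + 1) g(a) / (n − 1). Each step of
-- this recurrence adds at most 1, while g(b) ≤ (n − 1)/(k + 1) whenever b + k + 1 ≤ n − 1; splitting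
-- n − 1 = (k + 1) + b with (k + 1)² ≤ n − 1 < (k + 2)² gives σ ≤ (k + 1) + (n − 1)/(k + 1),
-- whose square is below 9n.

module Submission where

open import Defs

module Counting where

  open import Data.Bool.Base using (Bool; true; false; _∧_; not; if_then_else_)
  open import Data.Bool.Properties using (∧-identityʳ; ∧-zeroʳ)
  open import Data.Empty using (⊥-elim)
  open import Data.Fin.Base using (Fin; zero; suc; toℕ)
  open import Data.Fin.Properties using (suc-injective; _≟_)
  open import Data.List.Base using (foldr; tabulate)
  open import Data.Nat.Base using (ℕ; zero; suc; _+_; _∸_; _⊓_; _≤_; z≤n; s<s; s<s⁻¹)
  open import Data.Nat.Properties using (≤-refl; +-mono-≤; +-comm; +-assoc; m+n∸n≡m; ⊓-zeroʳ; _<?_)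
  open import Function.Base using (_∘_; id)
  open import Function.Bundles using (_⇔_; mk⇔; Equivalence)
  open import Relation.Binary.PropositionalEquality
  open import Relation.Nullary using (Dec; yes; no; ¬_)
  open import Relation.Nullary.Decidable using (isYes)

  private variable A B : Set

  isYes-yes : (a? : Dec A) → A → isYes a? ≡ true
  isYes-yes (yes _) _ = refl
  isYes-yes (no ¬a) a = ⊥-elim (¬a a)

  isYes-no : (a? : Dec A) → ¬ A → isYes a? ≡ false
  isYes-no (yes a) ¬a = ⊥-elim (¬a a)
  isYes-no (no _) _ = refl

  isYes-sound : (a? : Dec A) → isYes a? ≡ true → A
  isYes-sound (yes a) _ = a

  isYes-⇔ : A ⇔ B → (a? : Dec A) (b? : Dec B) → isYes a? ≡ isYes b?
  isYes-⇔ A⇔B a? (yes b) = isYes-yes a? (Equivalence.from A⇔B b)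
  isYes-⇔ A⇔B a? (no ¬b) = isYes-no a? (¬b ∘ Equivalence.to A⇔B)

  ∧-congˡ-guarded : ∀ a {b c} → (a ≡ true → b ≡ c) → a ∧ b ≡ a ∧ c
  ∧-congˡ-guarded false _   = refl
  ∧-congˡ-guarded true  b≡c = b≡c refl

  boolToℕ : Bool → ℕ
  boolToℕ b = if b then 1 else 0

  count : ∀ {n} → (Fin n → Bool) → ℕ
  count {zero}  P = 0
  count {suc n} P = boolToℕ (P zero) + count (P ∘ suc)

  countℕ≡count : ∀ {n} (P : Fin n → Bool) → countℕ P ≡ count P
  countℕ≡count P = foldr-tabulate P id
    where
    foldr-tabulate : ∀ {n k} (P : Fin k → Bool) (f : Fin n → Fin k) →
      foldr (λ j acc → boolToℕ (P j) + acc) 0 (tabulate f) ≡ count (P ∘ f)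
    foldr-tabulate {zero}  P f = refl
    foldr-tabulate {suc n} P f = cong (boolToℕ (P (f zero)) +_) (foldr-tabulate P (f ∘ suc))

  count-cong : ∀ {n} {P Q : Fin n → Bool} → (∀ v → P v ≡ Q v) → count P ≡ count Q
  count-cong {zero}  P≗Q = refl
  count-cong {suc n} P≗Q = cong₂ (λ b c → boolToℕ b + c) (P≗Q zero) (count-cong (P≗Q ∘ suc))

  count-mono : ∀ {n} {P Q : Fin n → Bool} → (∀ v → P v ≡ true → Q v ≡ true) → count P ≤ count Q
  count-mono {zero}  P⊆Q = z≤n
  count-mono {suc n} P⊆Q = +-mono-≤ (boolToℕ-mono (P⊆Q zero)) (count-mono (P⊆Q ∘ suc))
    where
    boolToℕ-mono : ∀ {a b} → (a ≡ true → b ≡ true) → boolToℕ a ≤ boolToℕ b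
    boolToℕ-mono {false} _   = z≤n
    boolToℕ-mono {true}  a⇒b rewrite a⇒b refl = ≤-refl

  count-all : ∀ n → count {n} (λ _ → true) ≡ n
  count-all zero    = refl
  count-all (suc n) = cong suc (count-all n)

  count-none : ∀ n → count {n} (λ _ → false) ≡ 0
  count-none zero    = refl
  count-none (suc n) = count-none n

  count-≤ : ∀ {n} (P : Fin n → Bool) → count P ≤ n
  count-≤ {n} P = subst (count P ≤_) (count-all n) (count-mono {n} {P} {λ _ → true} (λ _ _ → refl))

  count-below : ∀ k G → count {k} (λ b → isYes (toℕ b <? G)) ≡ G ⊓ k
  count-below zero    G       = sym (⊓-zeroʳ G)
  count-below (suc k) zero    = count-none k
  count-below (suc k) (suc G) = cong suc (trans
    (count-cong {k} (λ b → isYes-⇔ (mk⇔ s<s⁻¹ s<s) (suc (toℕ b) <? suc G) (toℕ b <? G)))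
    (count-below k G))

  remove : ∀ {n} → Fin n → (Fin n → Bool) → (Fin n → Bool)
  remove v P w = P w ∧ not (isYes (v ≟ w))

  remove-self : ∀ {n} (v : Fin n) (P : Fin n → Bool) → remove v P v ≡ false
  remove-self v P = trans (cong (λ b → P v ∧ not b) (isYes-yes (v ≟ v) refl)) (∧-zeroʳ (P v))

  count-remove : ∀ {n} (v : Fin n) (P : Fin n → Bool) → count P ≡ count (remove v P) + boolToℕ (P v)
  count-remove zero P = begin
    boolToℕ (P zero) + count (P ∘ suc)                                 ≡⟨ +-comm (boolToℕ (P zero)) _ ⟩
    count (P ∘ suc) + boolToℕ (P zero)                                 ≡⟨ cong₂ (λ b c → boolToℕ b + c + boolToℕ (P zero))
                                                                            (sym (∧-zeroʳ (P zero)))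
                                                                            (count-cong (λ w → sym (∧-identityʳ (P (suc w))))) ⟩
    count (remove zero P) + boolToℕ (P zero)                           ∎
    where open ≡-Reasoning
  count-remove (suc v) P = begin
    boolToℕ (P zero) + count (P ∘ suc)                                 ≡⟨ cong (boolToℕ (P zero) +_) (count-remove v (P ∘ suc)) ⟩
    boolToℕ (P zero) + (count (remove v (P ∘ suc)) + boolToℕ (P (suc v)))
                                                                       ≡⟨ sym (+-assoc (boolToℕ (P zero)) _ _) ⟩
    boolToℕ (P zero) + count (remove v (P ∘ suc)) + boolToℕ (P (suc v))
                                                                       ≡⟨ cong₂ (λ b c → boolToℕ b + c + boolToℕ (P (suc v)))
                                                                            (sym (∧-identityʳ (P zero)))
                                                                            (count-cong (λ w → cong (λ b → P (suc w) ∧ not b) (sym (≟-suc v w)))) ⟩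
    count (remove (suc v) P) + boolToℕ (P (suc v))                     ∎
    where
    open ≡-Reasoning
    ≟-suc : ∀ {n} (v w : Fin n) → isYes (suc v ≟ suc w) ≡ isYes (v ≟ w)
    ≟-suc v w = isYes-⇔ (mk⇔ suc-injective (cong suc)) (suc v ≟ suc w) (v ≟ w)

  count-remove-member : ∀ {n} (v : Fin n) (P : Fin n → Bool) → P v ≡ true → count P ≡ suc (count (remove v P))
  count-remove-member v P Pv = begin
    count P                                   ≡⟨ count-remove v P ⟩
    count (remove v P) + boolToℕ (P v)        ≡⟨ cong (λ b → count (remove v P) + boolToℕ b) Pv ⟩
    count (remove v P) + 1                    ≡⟨ +-comm _ 1 ⟩
    suc (count (remove v P))                  ∎
    where open ≡-Reasoning


  count-others : ∀ {n} (s : Fin n) → count (λ w → not (isYes (s ≟ w))) ≡ n ∸ 1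
  count-others {n} s = begin
    count (remove s (λ _ → true))             ≡⟨ sym (m+n∸n≡m _ 1) ⟩
    count (remove s (λ _ → true)) + 1 ∸ 1     ≡⟨ cong (_∸ 1) (sym (count-remove s (λ _ → true))) ⟩
    count {n} (λ _ → true) ∸ 1                ≡⟨ cong (_∸ 1) (count-all n) ⟩
    n ∸ 1                                     ∎
    where open ≡-Reasoning

module Escape where

  open Counting
  open import Data.Nat.Base using (ℕ; zero; suc; _+_; _≤_; _<_; z≤n; s≤s)
  open import Data.Nat.Properties
  open import Data.Sum using (inj₁; inj₂)
  open import Function.Bundles using (mk⇔)
  open import Relation.Binary.Definitions using (Monotonic₁)
  open import Relation.Binary.PropositionalEquality
  open import Relation.Nullary using (yes; no; contradiction)
  open import Relation.Nullary.Decidable using (isYes)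

  search : (ℕ → ℕ) → (fuel k : ℕ) → ℕ
  search N zero       k = k
  search N (suc fuel) k with N k <? k
  ... | yes _ = k
  ... | no  _ = search N fuel (suc k)

  search-≥ : ∀ N fuel k → k ≤ search N fuel k
  search-≥ N zero       k = ≤-refl
  search-≥ N (suc fuel) k with N k <? k
  ... | yes _ = ≤-refl
  ... | no  _ = ≤-trans (n≤1+n k) (search-≥ N fuel (suc k))

  search-exits : ∀ N {B} → (∀ j → N j ≤ B) → ∀ fuel k → B < k + fuel →
    N (search N fuel k) < search N fuel k
  search-exits N {B} N≤B zero       k B<k = ≤-<-trans (N≤B k) (subst (B <_) (+-identityʳ k) B<k)
  search-exits N {B} N≤B (suc fuel) k B<k with N k <? k
  ... | yes Nk<k = Nk<k
  ... | no  _    = search-exits N N≤B fuel (suc k) (subst (B <_) (+-suc k fuel) B<k)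

  search-skips : ∀ N fuel k j → k ≤ j → j < search N fuel k → j ≤ N j
  search-skips N zero       k j k≤j j<k = contradiction (≤-<-trans k≤j j<k) (<-irrefl refl)
  search-skips N (suc fuel) k j k≤j j<s with N k <? k
  ... | yes _ = contradiction (≤-<-trans k≤j j<s) (<-irrefl refl)
  ... | no Nk≮k with k ≟ j
  ...   | yes refl = ≮⇒≥ Nk≮k
  ...   | no  k≢j  = search-skips N fuel (suc k) j (≤∧≢⇒< k≤j k≢j) j<s

  -- The first k ≥ 1 with N k < k; when N is bounded by n it is found among 1, …, n + 1.
  escape : (ℕ → ℕ) → ℕ → ℕ
  escape N n = search N n 1

  module _ (N : ℕ → ℕ) (n : ℕ) where

    1≤escape : 1 ≤ escape N n
    1≤escape = search-≥ N n 1

    escape-skips : ∀ j → 1 ≤ j → j < escape N n → j ≤ N j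
    escape-skips = search-skips N n 1

    module _ (N≤n : ∀ j → N j ≤ n) where

      escape-exits : N (escape N n) < escape N n
      escape-exits = search-exits N N≤n n 1 ≤-refl

      escape-least : ∀ k → 1 ≤ k → N k < k → escape N n ≤ k
      escape-least k 1≤k Nk<k = ≮⇒≥ λ k<F → <-irrefl refl (<-≤-trans Nk<k (escape-skips k 1≤k k<F))

      escape-above : ∀ k → (∀ j → 1 ≤ j → j ≤ k → j ≤ N j) → k < escape N n
      escape-above k skips = ≰⇒> λ F≤k →
        <-irrefl refl (<-≤-trans escape-exits (skips (escape N n) 1≤escape F≤k))

      escape-fixed : Monotonic₁ _≤_ _≤_ N → escape N n ≡ suc (N (escape N n))
      escape-fixed mono = ≤-antisym (pred-bound (escape N n) 1≤escape escape-skips) escape-exits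
        where
        pred-bound : ∀ F → 1 ≤ F → (∀ j → 1 ≤ j → j < F → j ≤ N j) → F ≤ suc (N F)
        pred-bound (suc zero)    _ _     = s≤s z≤n
        pred-bound (suc (suc j)) _ skips = s≤s (≤-trans (skips (suc j) (s≤s z≤n) ≤-refl) (mono (n≤1+n (suc j))))

  escape-cong : ∀ {N N′} n → (∀ j → N j ≤ n) → (∀ j → N′ j ≤ n) → (∀ j → N j ≡ N′ j) →
    escape N n ≡ escape N′ n
  escape-cong {N} {N′} n N≤n N′≤n N≗N′ = ≤-antisym
    (escape-least N n N≤n _ (1≤escape N′ n) (subst (_< escape N′ n) (sym (N≗N′ _)) (escape-exits N′ n N′≤n)))
    (escape-least N′ n N′≤n _ (1≤escape N n) (subst (_< escape N n) (N≗N′ _) (escape-exits N n N≤n)))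

  -- If x < F′ then N F′ = F′, so N does not escape by F′; otherwise N and N′ agree at F′.
  escape-indicator : ∀ {N N′} n x → Monotonic₁ _≤_ _≤_ N′ →
    (∀ j → N j ≤ n) → (∀ j → N′ j ≤ n) →
    (∀ j → N j ≡ N′ j + boolToℕ (isYes (x <? j))) →
    isYes (x <? escape N n) ≡ isYes (x <? escape N′ n)
  escape-indicator {N} {N′} n x mono′ N≤n N′≤n split = isYes-⇔ (mk⇔ below below′) _ _
    where
    open ≤-Reasoning
    F  = escape N n
    F′ = escape N′ n

    below : x < F → x < F′
    below x<F = ≰⇒> λ F′≤x → <-irrefl refl (<-≤-trans x<F (≤-trans (F≤F′ F′≤x) F′≤x))
      where
      F≤F′ : F′ ≤ x → F ≤ F′
      F≤F′ F′≤x = escape-least N n N≤n F′ (1≤escape N′ n) (begin-strict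
        N F′                               ≡⟨ split F′ ⟩
        N′ F′ + boolToℕ (isYes (x <? F′))  ≡⟨ cong (λ b → N′ F′ + boolToℕ b) (isYes-no (x <? F′) (≤⇒≯ F′≤x)) ⟩
        N′ F′ + 0                          ≡⟨ +-identityʳ _ ⟩
        N′ F′                              <⟨ escape-exits N′ n N′≤n ⟩
        F′                                 ∎)

    below′ : x < F′ → x < F
    below′ x<F′ = <-trans x<F′ (escape-above N n N≤n F′ skips)
      where
      skips : ∀ j → 1 ≤ j → j ≤ F′ → j ≤ N j
      skips j 1≤j j≤F′ with m≤n⇒m<n∨m≡n j≤F′
      ... | inj₁ j<F′ = begin
        j                                  ≤⟨ escape-skips N′ n j 1≤j j<F′ ⟩
        N′ j                               ≤⟨ m≤m+n _ _ ⟩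
        N′ j + boolToℕ (isYes (x <? j))    ≡⟨ split j ⟨
        N j                                ∎
      ... | inj₂ refl = begin
        F′                                 ≡⟨ escape-fixed N′ n N′≤n mono′ ⟩
        suc (N′ F′)                        ≡⟨ +-comm 1 _ ⟩
        N′ F′ + 1                          ≡⟨ cong (λ b → N′ F′ + boolToℕ b) (isYes-yes (x <? F′) x<F′) ⟨
        N′ F′ + boolToℕ (isYes (x <? F′))  ≡⟨ split F′ ⟨
        N F′                               ∎


module Rationals where

  open import Data.Integer.Base using (+_)
  import Data.Integer.Base as ℤ
  import Data.Integer.Properties as ℤ
  open import Data.Integer.Tactic.RingSolver using (solve-∀)
  open import Data.Nat.Base as ℕ using (ℕ; zero; suc)
  import Data.Nat.Properties as ℕ
  open import Data.Rational.Base
  open import Data.Rational.Properties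
  import Data.Rational.Unnormalised.Base as ℚᵘ
  import Data.Rational.Unnormalised.Properties as ℚᵘ
  open import Data.Rational.Solver using (module +-*-Solver)
  open import Relation.Binary.PropositionalEquality
  open +-*-Solver using (solve; _:+_; _:*_; _:=_; con)

  fromℕ : ℕ → ℚ
  fromℕ k = + k / 1

  toℚᵘ-fromℕ : ∀ k → toℚᵘ (fromℕ k) ℚᵘ.≃ ℚᵘ.mkℚᵘ (+ k) 0
  toℚᵘ-fromℕ k = toℚᵘ-fromℚᵘ (ℚᵘ.mkℚᵘ (+ k) 0)

  fromℕ-+ : ∀ a b → fromℕ (a ℕ.+ b) ≡ fromℕ a + fromℕ b
  fromℕ-+ a b = toℚᵘ-injective (begin
    toℚᵘ (fromℕ (a ℕ.+ b))                              ≈⟨ toℚᵘ-fromℕ (a ℕ.+ b) ⟩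
    ℚᵘ.mkℚᵘ (+ (a ℕ.+ b)) 0                             ≈⟨ ℚᵘ.*≡* (trans (cong (ℤ._* + 1) (ℤ.pos-+ a b)) (sum-identity (+ a) (+ b))) ⟩
    ℚᵘ.mkℚᵘ (+ a) 0 ℚᵘ.+ ℚᵘ.mkℚᵘ (+ b) 0                 ≈⟨ ℚᵘ.+-cong (toℚᵘ-fromℕ a) (toℚᵘ-fromℕ b) ⟨
    toℚᵘ (fromℕ a) ℚᵘ.+ toℚᵘ (fromℕ b)                  ≈⟨ toℚᵘ-homo-+ (fromℕ a) (fromℕ b) ⟨
    toℚᵘ (fromℕ a + fromℕ b)                            ∎)
    where
    open ℚᵘ.≃-Reasoning
    sum-identity : ∀ x y → (x ℤ.+ y) ℤ.* + 1 ≡ (x ℤ.* + 1 ℤ.+ y ℤ.* + 1) ℤ.* + 1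
    sum-identity = solve-∀

  fromℕ-suc : ∀ k → fromℕ (suc k) ≡ 1ℚ + fromℕ k
  fromℕ-suc = fromℕ-+ 1

  fromℕ-suc-* : ∀ k c → fromℕ (suc k) * c ≡ c + fromℕ k * c
  fromℕ-suc-* k c = trans (cong (_* c) (fromℕ-suc k)) (distrib (fromℕ k) c)
    where
    distrib : ∀ x y → (1ℚ + x) * y ≡ y + x * y
    distrib = solve 2 (λ x y → (con 1ℚ :+ x) :* y := y :+ x :* y) refl

  fromℕ-* : ∀ a b → fromℕ (a ℕ.* b) ≡ fromℕ a * fromℕ b
  fromℕ-* zero    b = sym (*-zeroˡ (fromℕ b))
  fromℕ-* (suc a) b = begin
    fromℕ (b ℕ.+ a ℕ.* b)          ≡⟨ fromℕ-+ b (a ℕ.* b) ⟩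
    fromℕ b + fromℕ (a ℕ.* b)      ≡⟨ cong (_+_ (fromℕ b)) (fromℕ-* a b) ⟩
    fromℕ b + fromℕ a * fromℕ b    ≡⟨ fromℕ-suc-* a (fromℕ b) ⟨
    fromℕ (suc a) * fromℕ b        ∎
    where open ≡-Reasoning

  fromℕ-nonNeg : ∀ k → 0ℚ ≤ fromℕ k
  fromℕ-nonNeg k = nonNegative⁻¹ (fromℕ k) {{normalize-nonNeg k 1}}

  fromℕ-mono-≤ : ∀ {a b} → a ℕ.≤ b → fromℕ a ≤ fromℕ b
  fromℕ-mono-≤ {a} {b} a≤b = begin
    fromℕ a                       ≡⟨ +-identityʳ (fromℕ a) ⟨
    fromℕ a + 0ℚ                  ≤⟨ +-monoʳ-≤ (fromℕ a) (fromℕ-nonNeg (b ℕ.∸ a)) ⟩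
    fromℕ a + fromℕ (b ℕ.∸ a)     ≡⟨ fromℕ-+ a (b ℕ.∸ a) ⟨
    fromℕ (a ℕ.+ (b ℕ.∸ a))       ≡⟨ cong fromℕ (ℕ.m+[n∸m]≡n a≤b) ⟩
    fromℕ b                       ∎
    where open ≤-Reasoning

  fromℕ-mono-< : ∀ {a b} → a ℕ.< b → fromℕ a < fromℕ b
  fromℕ-mono-< {a} {b} a<b = begin-strict
    fromℕ a              ≡⟨ +-identityˡ (fromℕ a) ⟨
    0ℚ + fromℕ a         <⟨ +-monoˡ-< (fromℕ a) (positive⁻¹ 1ℚ) ⟩
    1ℚ + fromℕ a         ≡⟨ fromℕ-suc a ⟨
    fromℕ (suc a)        ≤⟨ fromℕ-mono-≤ a<b ⟩
    fromℕ b              ∎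
    where open ≤-Reasoning

  -- 1 / (M + 1) in the form used by expect, so that it matches definitionally.
  recipSuc : ℕ → ℚ
  recipSuc M = + 1 / suc M

  recipSuc-nonNeg : ∀ M → 0ℚ ≤ recipSuc M
  recipSuc-nonNeg M = nonNegative⁻¹ (recipSuc M) {{normalize-nonNeg 1 (suc M)}}

  fromℕ-suc*recipSuc : ∀ M → fromℕ (suc M) * recipSuc M ≡ 1ℚ
  fromℕ-suc*recipSuc M = toℚᵘ-injective (begin
    toℚᵘ (fromℕ (suc M) * recipSuc M)                  ≈⟨ toℚᵘ-homo-* (fromℕ (suc M)) (recipSuc M) ⟩
    toℚᵘ (fromℕ (suc M)) ℚᵘ.* toℚᵘ (recipSuc M)        ≈⟨ ℚᵘ.*-cong (toℚᵘ-fromℕ (suc M)) (toℚᵘ-fromℚᵘ (ℚᵘ.mkℚᵘ (+ 1) M)) ⟩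
    ℚᵘ.mkℚᵘ (+ suc M) 0 ℚᵘ.* ℚᵘ.mkℚᵘ (+ 1) M           ≈⟨ ℚᵘ.*≡* (trans (unit-identity (+ suc M)) (cong (+ 1 ℤ.*_) (sym (ℤ.pos-* 1 (suc M))))) ⟩
    ℚᵘ.mkℚᵘ (+ 1) 0                                     ∎)
    where
    open ℚᵘ.≃-Reasoning
    unit-identity : ∀ x → (x ℤ.* + 1) ℤ.* + 1 ≡ + 1 ℤ.* (+ 1 ℤ.* x)
    unit-identity = solve-∀

  ≥0*≥0⇒≥0 : ∀ {p q} → 0ℚ ≤ p → 0ℚ ≤ q → 0ℚ ≤ p * q
  ≥0*≥0⇒≥0 {p} {q} p≥0 q≥0 = nonNegative⁻¹ (p * q) {{nonNeg*nonNeg⇒nonNeg p {{nonNegative p≥0}} q {{nonNegative q≥0}}}}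

  *-monoʳ-≤-≥0 : ∀ {r p q} → 0ℚ ≤ r → p ≤ q → p * r ≤ q * r
  *-monoʳ-≤-≥0 {r} r≥0 = *-monoʳ-≤-nonNeg r {{nonNegative r≥0}}

  *-monoˡ-≤-≥0 : ∀ {r p q} → 0ℚ ≤ r → p ≤ q → r * p ≤ r * q
  *-monoˡ-≤-≥0 {r} r≥0 = *-monoˡ-≤-nonNeg r {{nonNegative r≥0}}


module Expectation where

  open Rationals
  open import Data.Fin.Base using (Fin; zero; suc)
  open import Data.List.Base using (map; tabulate)
  open import Data.Nat.Base as ℕ using (ℕ; zero; suc)
  open import Data.Rational.Base using (ℚ; 0ℚ; 1ℚ; _+_; _*_; _≤_)
  open import Data.Rational.Properties
  open import Function.Base using (_∘_; id)
  open import Data.Rational.Solver using (module +-*-Solver)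
  open import Relation.Binary.PropositionalEquality
  open +-*-Solver using (solve; _:+_; _:*_; _:=_)
  open import Relation.Nullary using (contradiction)

  ∑ : ∀ {k} → (Fin k → ℚ) → ℚ
  ∑ {zero}  h = 0ℚ
  ∑ {suc k} h = h zero + ∑ (h ∘ suc)

  sumℚ-map-tabulate : ∀ {n k} (h : Fin k → ℚ) (f : Fin n → Fin k) → sumℚ (map h (tabulate f)) ≡ ∑ (h ∘ f)
  sumℚ-map-tabulate {zero}  h f = refl
  sumℚ-map-tabulate {suc n} h f = cong (_+_ (h (f zero))) (sumℚ-map-tabulate h (f ∘ suc))

  ∑-cong : ∀ {k} {h h′ : Fin k → ℚ} → (∀ i → h i ≡ h′ i) → ∑ h ≡ ∑ h′
  ∑-cong {zero}  h≗h′ = refl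
  ∑-cong {suc k} h≗h′ = cong₂ _+_ (h≗h′ zero) (∑-cong (h≗h′ ∘ suc))

  ∑-+ : ∀ {k} (h h′ : Fin k → ℚ) → ∑ (λ i → h i + h′ i) ≡ ∑ h + ∑ h′
  ∑-+ {zero}  h h′ = sym (+-identityˡ 0ℚ)
  ∑-+ {suc k} h h′ = trans (cong (_+_ (h zero + h′ zero)) (∑-+ (h ∘ suc) (h′ ∘ suc)))
                           (interchange (h zero) (h′ zero) _ _)
    where
    interchange : ∀ a b c d → (a + b) + (c + d) ≡ (a + c) + (b + d)
    interchange = solve 4 (λ a b c d → (a :+ b) :+ (c :+ d) := (a :+ c) :+ (b :+ d)) refl

  ∑-*ʳ : ∀ {k} (h : Fin k → ℚ) c → ∑ (λ i → h i * c) ≡ ∑ h * c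
  ∑-*ʳ {zero}  h c = sym (*-zeroˡ c)
  ∑-*ʳ {suc k} h c = trans (cong (_+_ (h zero * c)) (∑-*ʳ (h ∘ suc) c)) (sym (*-distribʳ-+ c (h zero) _))

  ∑-const : ∀ k c → ∑ {k} (λ _ → c) ≡ fromℕ k * c
  ∑-const zero    c = sym (*-zeroˡ c)
  ∑-const (suc k) c = trans (cong (_+_ c) (∑-const k c)) (sym (fromℕ-suc-* k c))

  ∑-mono : ∀ {k} {h h′ : Fin k → ℚ} → (∀ i → h i ≤ h′ i) → ∑ h ≤ ∑ h′
  ∑-mono {zero}  h≤h′ = ≤-refl
  ∑-mono {suc k} h≤h′ = +-mono-≤ (h≤h′ zero) (∑-mono (h≤h′ ∘ suc))

  mean : (M : ℕ) → (Fin (suc M) → ℚ) → ℚ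
  mean M h = ∑ h * recipSuc M

  mean-cong : ∀ M {h h′} → (∀ i → h i ≡ h′ i) → mean M h ≡ mean M h′
  mean-cong M h≗h′ = cong (_* recipSuc M) (∑-cong h≗h′)

  mean-const : ∀ M c → mean M (λ _ → c) ≡ c
  mean-const M c = begin
    ∑ {suc M} (λ _ → c) * recipSuc M           ≡⟨ cong (_* recipSuc M) (∑-const (suc M) c) ⟩
    fromℕ (suc M) * c * recipSuc M             ≡⟨ rearrange (fromℕ (suc M)) c (recipSuc M) ⟩
    c * (fromℕ (suc M) * recipSuc M)           ≡⟨ cong (c *_) (fromℕ-suc*recipSuc M) ⟩
    c * 1ℚ                                     ≡⟨ *-identityʳ c ⟩
    c                                          ∎
    where
    open ≡-Reasoning
    rearrange : ∀ x y z → x * y * z ≡ y * (x * z)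
    rearrange = solve 3 (λ x y z → x :* y :* z := y :* (x :* z)) refl

  mean-mono : ∀ M {h h′} → (∀ i → h i ≤ h′ i) → mean M h ≤ mean M h′
  mean-mono M h≤h′ = *-monoʳ-≤-≥0 (recipSuc-nonNeg M) (∑-mono h≤h′)

  mean-+ : ∀ M h h′ → mean M (λ i → h i + h′ i) ≡ mean M h + mean M h′
  mean-+ M h h′ = trans (cong (_* recipSuc M) (∑-+ h h′)) (*-distribʳ-+ (recipSuc M) (∑ h) (∑ h′))

  mean-*ʳ : ∀ M h c → mean M (λ i → h i * c) ≡ mean M h * c
  mean-*ʳ M h c = trans (cong (_* recipSuc M) (∑-*ʳ h c)) (swap (∑ h) c (recipSuc M))
    where
    swap : ∀ x y z → x * y * z ≡ x * z * y
    swap = solve 3 (λ x y z → x :* y :* z := x :* z :* y) refl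

  Choice : (n : ℕ) → (Fin n → ℕ) → Set
  Choice n m = (v : Fin n) → Fin (suc (m v))

  expect-suc : ∀ n m (f : Choice (suc n) m → ℚ) →
    expect (suc n) m f ≡ mean (m zero) (λ a → expect n (m ∘ suc) (f ∘ consF {m = m} a))
  expect-suc n m f = cong (_* recipSuc (m zero)) (sumℚ-map-tabulate (λ a → expect n (m ∘ suc) (f ∘ consF {m = m} a)) id)

  expect-cong : ∀ n m {f f′ : Choice n m → ℚ} → (∀ θ → f θ ≡ f′ θ) → expect n m f ≡ expect n m f′
  expect-cong zero    m f≗f′ = f≗f′ _
  expect-cong (suc n) m {f} {f′} f≗f′ = trans (expect-suc n m f)
    (trans (mean-cong (m zero) (λ a → expect-cong n (m ∘ suc) (f≗f′ ∘ consF {m = m} a)))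
           (sym (expect-suc n m f′)))

  expect-const : ∀ n m c → expect n m (λ _ → c) ≡ c
  expect-const zero    m c = refl
  expect-const (suc n) m c = trans (expect-suc n m (λ _ → c))
    (trans (mean-cong (m zero) (λ _ → expect-const n (m ∘ suc) c)) (mean-const (m zero) c))

  expect-mono : ∀ n m {f f′ : Choice n m → ℚ} → (∀ θ → f θ ≤ f′ θ) → expect n m f ≤ expect n m f′
  expect-mono zero    m f≤f′ = f≤f′ _
  expect-mono (suc n) m {f} {f′} f≤f′ = subst₂ _≤_ (sym (expect-suc n m f)) (sym (expect-suc n m f′))
    (mean-mono (m zero) (λ a → expect-mono n (m ∘ suc) (f≤f′ ∘ consF {m = m} a)))

  expect-+ : ∀ n m (f f′ : Choice n m → ℚ) → expect n m (λ θ → f θ + f′ θ) ≡ expect n m f + expect n m f′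
  expect-+ zero    m f f′ = refl
  expect-+ (suc n) m f f′ = trans (expect-suc n m (λ θ → f θ + f′ θ))
    (trans (mean-cong (m zero) (λ a → expect-+ n (m ∘ suc) (f ∘ consF {m = m} a) (f′ ∘ consF {m = m} a)))
    (trans (mean-+ (m zero) (section f) (section f′)) (sym (cong₂ _+_ (expect-suc n m f) (expect-suc n m f′)))))
    where
    section : (Choice (suc n) m → ℚ) → Fin (suc (m zero)) → ℚ
    section g a = expect n (m ∘ suc) (g ∘ consF {m = m} a)

  expect-*ʳ : ∀ n m (f : Choice n m → ℚ) c → expect n m (λ θ → f θ * c) ≡ expect n m f * c
  expect-*ʳ zero    m f c = refl
  expect-*ʳ (suc n) m f c = trans (expect-suc n m (λ θ → f θ * c))
    (trans (mean-cong (m zero) (λ a → expect-*ʳ n (m ∘ suc) (f ∘ consF {m = m} a) c))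
    (trans (mean-*ʳ (m zero) (λ a → expect n (m ∘ suc) (f ∘ consF {m = m} a)) c)
           (sym (cong (_* c) (expect-suc n m f)))))

  expect-∑ : ∀ n m {k} (h : Fin k → Choice n m → ℚ) →
    expect n m (λ θ → ∑ (λ i → h i θ)) ≡ ∑ (λ i → expect n m (h i))
  expect-∑ n m {zero}  h = expect-const n m 0ℚ
  expect-∑ n m {suc k} h = trans (expect-+ n m (h zero) (λ θ → ∑ (λ i → h (suc i) θ)))
    (cong (_+_ (expect n m (h zero))) (expect-∑ n m (h ∘ suc)))

  expect-mean : ∀ n m M (h : Fin (suc M) → Choice n m → ℚ) →
    expect n m (λ θ → mean M (λ i → h i θ)) ≡ mean M (λ i → expect n m (h i))
  expect-mean n m M h = trans (expect-*ʳ n m (λ θ → ∑ (λ i → h i θ)) (recipSuc M))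
    (cong (_* recipSuc M) (expect-∑ n m h))

  update : ∀ {n} {m : Fin n → ℕ} → Choice n m → (v : Fin n) → Fin (suc (m v)) → Choice n m
  update {suc n} {m} θ zero    a = consF {m = m} a (θ ∘ suc)
  update {suc n} {m} θ (suc v) a = consF {m = m} (θ zero) (update (θ ∘ suc) v a)

  update-same : ∀ {n} {m : Fin n → ℕ} (θ : Choice n m) v a → update θ v a v ≡ a
  update-same {suc n} θ zero    a = refl
  update-same {suc n} θ (suc v) a = update-same (θ ∘ suc) v a

  update-other : ∀ {n} {m : Fin n → ℕ} (θ : Choice n m) v a w → v ≢ w → update θ v a w ≡ θ w
  update-other {suc n} θ zero    a zero    v≢w = contradiction refl v≢w
  update-other {suc n} θ zero    a (suc w) v≢w = refl
  update-other {suc n} θ (suc v) a zero    v≢w = refl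
  update-other {suc n} θ (suc v) a (suc w) v≢w = update-other (θ ∘ suc) v a w (v≢w ∘ cong suc)

  expect-resample : ∀ n m v (f : Choice n m → ℚ) →
    expect n m f ≡ expect n m (λ θ → mean (m v) (λ a → f (update θ v a)))
  expect-resample (suc n) m zero f = begin
    expect (suc n) m f                                              ≡⟨ expect-suc n m f ⟩
    mean (m zero) (λ a → expect n (m ∘ suc) (f ∘ consF {m = m} a))  ≡⟨ mean-const (m zero) _ ⟨
    mean (m zero) (λ _ → mean (m zero) (λ a → expect n (m ∘ suc) (f ∘ consF {m = m} a)))
          ≡⟨ mean-cong (m zero) (λ _ → expect-mean n (m ∘ suc) (m zero) (λ a → f ∘ consF {m = m} a)) ⟨
    mean (m zero) (λ _ → expect n (m ∘ suc) (λ g → mean (m zero) (λ a → f (consF {m = m} a g))))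
          ≡⟨ expect-suc n m (λ θ → mean (m zero) (λ a → f (update θ zero a))) ⟨
    expect (suc n) m (λ θ → mean (m zero) (λ a → f (update θ zero a)))  ∎
    where open ≡-Reasoning
  expect-resample (suc n) m (suc v) f = trans (expect-suc n m f)
    (trans (mean-cong (m zero) (λ a → expect-resample n (m ∘ suc) v (f ∘ consF {m = m} a)))
           (sym (expect-suc n m (λ θ → mean (m (suc v)) (λ b → f (update θ (suc v) b))))))


module CascadeExpectation where

  open Counting
  open Escape
  open Rationals
  open Expectation
  open import Data.Bool.Base using (Bool; true; false; _∧_)
  open import Data.Bool.Properties using (∧-assoc; ∧-comm; ∧-conicalˡ)
  open import Data.Fin.Base as Fin using (Fin; toℕ)
  open import Data.Nat.Base as ℕ using (ℕ; zero; suc; _≤_; _<_; z≤n; s≤s)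
  open import Data.Nat.Properties as ℕ using (_<?_)
  open import Data.Rational.Base using (ℚ; 0ℚ; 1ℚ; _+_; _*_)
  open import Data.Rational.Properties using (*-zeroˡ; *-identityˡ)
  open import Function.Base using (_∘_; case_of_)
  open import Relation.Binary.Definitions using (Monotonic₁)
  open import Relation.Binary.PropositionalEquality
  open import Relation.Nullary.Decidable using (isYes)

  indicator : Bool → ℚ
  indicator b = fromℕ (boolToℕ b)

  fromℕ-count : ∀ {n} (P : Fin n → Bool) → fromℕ (count P) ≡ ∑ (indicator ∘ P)
  fromℕ-count {zero}  P = refl
  fromℕ-count {suc n} P = trans (fromℕ-+ (boolToℕ (P Fin.zero)) (count (P ∘ Fin.suc))) (cong (_+_ (indicator (P Fin.zero))) (fromℕ-count (P ∘ Fin.suc)))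

  mean-indicator-below : ∀ M G → G ≤ suc M → mean M (λ b → indicator (isYes (toℕ b <? G))) ≡ fromℕ G * recipSuc M
  mean-indicator-below M G G≤1+M = cong (_* recipSuc M) (begin
    ∑ {suc M} (λ b → indicator (isYes (toℕ b <? G))) ≡⟨ fromℕ-count {suc M} (λ b → isYes (toℕ b <? G)) ⟨
    fromℕ (count {suc M} (λ b → isYes (toℕ b <? G))) ≡⟨ cong fromℕ (count-below (suc M) G) ⟩
    fromℕ (G ℕ.⊓ suc M)                            ≡⟨ cong fromℕ (ℕ.m≤n⇒m⊓n≡m G≤1+M) ⟩
    fromℕ G                                        ∎)
    where open ≡-Reasoning

  -- The expected cascade size when a candidates each have a threshold uniform on R + 1 values.
  -- Opaque: letting the conversion checker unfold rational arithmetic is prohibitively slow.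
  opaque
    meanCascade : ℕ → ℕ → ℚ
    meanCascade R zero    = 1ℚ
    meanCascade R (suc a) = 1ℚ + fromℕ (suc a) * (meanCascade R a * recipSuc R)

    meanCascade-zero : ∀ R → meanCascade R zero ≡ 1ℚ
    meanCascade-zero R = refl

    meanCascade-suc : ∀ R a → meanCascade R (suc a) ≡ 1ℚ + fromℕ (suc a) * (meanCascade R a * recipSuc R)
    meanCascade-suc R a = refl

  -- On the complete graph with infected set of size k, an uninfected vertex v becomes
  -- infected iff its threshold toℕ (θ v) + 1 is at most k, i.e. toℕ (θ v) < k.
  module Cascade (n : ℕ) (m : Fin n → ℕ) where

    activated : (Fin n → Bool) → Choice n m → ℕ → ℕ
    activated P θ k = count (λ v → P v ∧ isYes (toℕ (θ v) <? k))

    cascade : (Fin n → Bool) → Choice n m → ℕ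
    cascade P θ = escape (activated P θ) n

    activated-≤ : ∀ P θ k → activated P θ k ≤ n
    activated-≤ P θ k = count-≤ _

    activated-mono : ∀ P θ → Monotonic₁ _≤_ _≤_ (activated P θ)
    activated-mono P θ i≤j = count-mono λ v → widen (P v) (isYes-mono (toℕ (θ v)))
      where
      isYes-mono : ∀ x → isYes (x <? _) ≡ true → isYes (x <? _) ≡ true
      isYes-mono x below = isYes-yes (x <? _) (ℕ.<-≤-trans (isYes-sound (x <? _) below) i≤j)
      widen : ∀ a {b c} → (b ≡ true → c ≡ true) → a ∧ b ≡ true → a ∧ c ≡ true
      widen true b⇒c = b⇒c

    activated-≤-count : ∀ P θ k → activated P θ k ≤ count P
    activated-≤-count P θ k = count-mono λ v → ∧-conicalˡ (P v) _

    cascade-fixed : ∀ P θ → cascade P θ ≡ suc (activated P θ (cascade P θ))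
    cascade-fixed P θ = escape-fixed (activated P θ) n (activated-≤ P θ) (activated-mono P θ)

    cascade-≤ : ∀ P θ → cascade P θ ≤ suc (count P)
    cascade-≤ P θ = escape-least (activated P θ) n (activated-≤ P θ) (suc (count P)) (s≤s z≤n)
      (s≤s (activated-≤-count P θ _))

    cascade-none : ∀ P θ → count P ≡ 0 → cascade P θ ≡ 1
    cascade-none P θ |P|≡0 = ℕ.≤-antisym (subst (λ c → cascade P θ ≤ suc c) |P|≡0 (cascade-≤ P θ))
      (1≤escape (activated P θ) n)

    activated-remove : ∀ P θ v → P v ≡ true → ∀ k →
      activated P θ k ≡ activated (remove v P) θ k ℕ.+ boolToℕ (isYes (toℕ (θ v) <? k))
    activated-remove P θ v Pv k = trans (count-remove v _)
      (cong₂ (λ c b → c ℕ.+ boolToℕ (b ∧ _)) (count-cong λ w → swap (P w) _ _) Pv)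
      where
      swap : ∀ a b c → (a ∧ b) ∧ c ≡ (a ∧ c) ∧ b
      swap a b c = trans (∧-assoc a b c) (trans (cong (a ∧_) (∧-comm b c)) (sym (∧-assoc a c b)))

    cascade-remove : ∀ P θ v → P v ≡ true →
      isYes (toℕ (θ v) <? cascade P θ) ≡ isYes (toℕ (θ v) <? cascade (remove v P) θ)
    cascade-remove P θ v Pv = escape-indicator n (toℕ (θ v)) (activated-mono (remove v P) θ)
      (activated-≤ P θ) (activated-≤ (remove v P) θ) (activated-remove P θ v Pv)

    cascade-local : ∀ P θ θ′ → (∀ w → P w ≡ true → θ w ≡ θ′ w) → cascade P θ ≡ cascade P θ′
    cascade-local P θ θ′ θ≗θ′ = escape-cong n (activated-≤ P θ) (activated-≤ P θ′)
      λ k → count-cong λ w → ∧-congˡ-guarded (P w) (λ Pw → cong (λ t → isYes (toℕ t <? k)) (θ≗θ′ w Pw))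

    fires : (Fin n → Bool) → Choice n m → Fin n → Bool
    fires P θ v = isYes (toℕ (θ v) <? cascade (remove v P) θ)

    fromℕ-cascade : ∀ P θ → fromℕ (cascade P θ) ≡ 1ℚ + ∑ (λ v → indicator (P v ∧ fires P θ v))
    fromℕ-cascade P θ = begin
      fromℕ (cascade P θ)                                  ≡⟨ cong fromℕ (cascade-fixed P θ) ⟩
      fromℕ (suc (activated P θ (cascade P θ)))            ≡⟨ fromℕ-suc (activated P θ (cascade P θ)) ⟩
      1ℚ + fromℕ (activated P θ (cascade P θ))             ≡⟨ cong (λ c → 1ℚ + fromℕ c)
                                                                (count-cong λ v → ∧-congˡ-guarded (P v) (cascade-remove P θ v)) ⟩
      1ℚ + fromℕ (count (λ v → P v ∧ fires P θ v))         ≡⟨ cong (_+_ 1ℚ) (fromℕ-count (λ v → P v ∧ fires P θ v)) ⟩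
      1ℚ + ∑ (λ v → indicator (P v ∧ fires P θ v))         ∎
      where open ≡-Reasoning

    -- The cascade of a set Q not containing v is independent of θ v, which is uniform on m v + 1 values.
    expect-below-cascade : ∀ v Q → Q v ≡ false → (∀ θ → cascade Q θ ≤ suc (m v)) →
      expect n m (λ θ → indicator (isYes (toℕ (θ v) <? cascade Q θ)))
        ≡ expect n m (fromℕ ∘ cascade Q) * recipSuc (m v)
    expect-below-cascade v Q Qv≡false bound = begin
      expect n m (λ θ → indicator (isYes (toℕ (θ v) <? cascade Q θ)))
        ≡⟨ expect-resample n m v _ ⟩
      expect n m (λ θ → mean (m v) (λ b → indicator (isYes (toℕ (update θ v b v) <? cascade Q (update θ v b)))))
        ≡⟨ expect-cong n m (λ θ → mean-cong (m v) λ b → cong₂ (λ t c → indicator (isYes (toℕ t <? c)))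
             (update-same θ v b) (cascade-local Q (update θ v b) θ (λ w Qw → update-other θ v b w (v∉Q w Qw)))) ⟩
      expect n m (λ θ → mean (m v) (λ b → indicator (isYes (toℕ b <? cascade Q θ))))
        ≡⟨ expect-cong n m (λ θ → mean-indicator-below (m v) (cascade Q θ) (bound θ)) ⟩
      expect n m (λ θ → fromℕ (cascade Q θ) * recipSuc (m v))
        ≡⟨ expect-*ʳ n m (fromℕ ∘ cascade Q) (recipSuc (m v)) ⟩
      expect n m (fromℕ ∘ cascade Q) * recipSuc (m v)  ∎
      where
      open ≡-Reasoning
      v∉Q : ∀ w → Q w ≡ true → v ≢ w
      v∉Q w Qw refl = case trans (sym Qw) Qv≡false of λ ()

    expect-guarded : ∀ b {X : Choice n m → Bool} c → (b ≡ true → expect n m (indicator ∘ X) ≡ c) →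
      expect n m (λ θ → indicator (b ∧ X θ)) ≡ indicator b * c
    expect-guarded false c _  = trans (expect-const n m 0ℚ) (sym (*-zeroˡ c))
    expect-guarded true  c E≡c = trans (E≡c refl) (sym (*-identityˡ c))

    expect-cascade : ∀ R → (∀ v → m v ≡ R) → ∀ a P → count P ≡ a → a ≤ suc R →
      expect n m (fromℕ ∘ cascade P) ≡ meanCascade R a
    expect-cascade R m≗R zero P |P|≡0 _ =
      trans (expect-cong n m (λ θ → cong fromℕ (cascade-none P θ |P|≡0)))
            (trans (expect-const n m 1ℚ) (sym (meanCascade-zero R)))
    expect-cascade R m≗R (suc a) P |P|≡1+a 1+a≤1+R = begin
      expect n m (fromℕ ∘ cascade P)                        ≡⟨ expect-cong n m (fromℕ-cascade P) ⟩
      expect n m (λ θ → 1ℚ + ∑ (λ v → term v θ))            ≡⟨ expect-+ n m (λ _ → 1ℚ) (λ θ → ∑ (λ v → term v θ)) ⟩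
      expect n m (λ _ → 1ℚ) + expect n m (λ θ → ∑ (λ v → term v θ))
                                                            ≡⟨ cong₂ _+_ (expect-const n m 1ℚ) (expect-∑ n m term) ⟩
      1ℚ + ∑ (λ v → expect n m (term v))                    ≡⟨ cong (_+_ 1ℚ) (∑-cong expect-term) ⟩
      1ℚ + ∑ (λ v → indicator (P v) * c)                    ≡⟨ cong (_+_ 1ℚ) (∑-*ʳ (indicator ∘ P) c) ⟩
      1ℚ + ∑ (indicator ∘ P) * c                            ≡⟨ cong (λ x → 1ℚ + x * c) (fromℕ-count P) ⟨
      1ℚ + fromℕ (count P) * c                              ≡⟨ cong (λ k → 1ℚ + fromℕ k * c) |P|≡1+a ⟩
      1ℚ + fromℕ (suc a) * c                                ≡⟨ meanCascade-suc R a ⟨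
      meanCascade R (suc a)                                 ∎
      where
      open ≡-Reasoning
      c = meanCascade R a * recipSuc R
      term : Fin n → Choice n m → ℚ
      term v θ = indicator (P v ∧ fires P θ v)
      count-remove≡a : ∀ v → P v ≡ true → count (remove v P) ≡ a
      count-remove≡a v Pv = ℕ.suc-injective (trans (sym (count-remove-member v P Pv)) |P|≡1+a)
      bound : ∀ v → P v ≡ true → ∀ θ → cascade (remove v P) θ ≤ suc (m v)
      bound v Pv θ = subst (λ r → cascade (remove v P) θ ≤ suc r) (sym (m≗R v))
        (ℕ.≤-trans (subst (λ k → cascade (remove v P) θ ≤ suc k) (count-remove≡a v Pv) (cascade-≤ (remove v P) θ)) 1+a≤1+R)
      expect-term : ∀ v → expect n m (term v) ≡ indicator (P v) * c
      expect-term v = expect-guarded (P v) c λ Pv → begin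
        expect n m (λ θ → indicator (fires P θ v))                    ≡⟨ expect-below-cascade v (remove v P) (remove-self v P) (bound v Pv) ⟩
        expect n m (fromℕ ∘ cascade (remove v P)) * recipSuc (m v)    ≡⟨ cong₂ (λ e r → e * recipSuc r)
                                                                           (expect-cascade R m≗R a (remove v P) (count-remove≡a v Pv) (ℕ.<⇒≤ 1+a≤1+R))
                                                                           (m≗R v) ⟩
        c                                                             ∎


module MeanCascadeBounds where

  open Rationals
  open CascadeExpectation using (meanCascade; meanCascade-zero; meanCascade-suc)
  open import Data.Nat.Base as ℕ using (ℕ; zero; suc)
  import Data.Nat.Properties as ℕ
  open import Data.Rational.Base using (0ℚ; 1ℚ; _+_; _*_; _≤_)
  open import Data.Rational.Properties
  open import Data.Rational.Solver using (module +-*-Solver)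
  open import Relation.Binary.PropositionalEquality
  open +-*-Solver using (solve; _:+_; _:*_; _:=_; con)

  meanCascade-nonNeg : ∀ R a → 0ℚ ≤ meanCascade R a
  meanCascade-nonNeg R zero    = subst (0ℚ ≤_) (sym (meanCascade-zero R)) (fromℕ-nonNeg 1)
  meanCascade-nonNeg R (suc a) = subst₂ _≤_ (+-identityʳ 0ℚ) (sym (meanCascade-suc R a))
    (+-mono-≤ (fromℕ-nonNeg 1)
      (≥0*≥0⇒≥0 (fromℕ-nonNeg (suc a)) (≥0*≥0⇒≥0 (meanCascade-nonNeg R a) (recipSuc-nonNeg R))))

  meanCascade-suc-≤ : ∀ R a → suc a ℕ.≤ suc R → meanCascade R (suc a) ≤ 1ℚ + meanCascade R a
  meanCascade-suc-≤ R a 1+a≤1+R = begin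
    meanCascade R (suc a)                      ≡⟨ meanCascade-suc R a ⟩
    1ℚ + fromℕ (suc a) * (g * recipSuc R)      ≡⟨ cong (_+_ 1ℚ) (rearrange (fromℕ (suc a)) g (recipSuc R)) ⟩
    1ℚ + fromℕ (suc a) * recipSuc R * g        ≤⟨ +-monoʳ-≤ 1ℚ (*-monoʳ-≤-≥0 (meanCascade-nonNeg R a)
                                                    (*-monoʳ-≤-≥0 (recipSuc-nonNeg R) (fromℕ-mono-≤ 1+a≤1+R))) ⟩
    1ℚ + fromℕ (suc R) * recipSuc R * g        ≡⟨ cong (λ x → 1ℚ + x * g) (fromℕ-suc*recipSuc R) ⟩
    1ℚ + 1ℚ * g                                ≡⟨ cong (_+_ 1ℚ) (*-identityˡ g) ⟩
    1ℚ + g                                     ∎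
    where
    open ≤-Reasoning
    g = meanCascade R a
    rearrange : ∀ x y z → x * (y * z) ≡ x * z * y
    rearrange = solve 3 (λ x y z → x :* (y :* z) := x :* z :* y) refl

  meanCascade-+-≤ : ∀ R j b → j ℕ.+ b ℕ.≤ suc R → meanCascade R (j ℕ.+ b) ≤ fromℕ j + meanCascade R b
  meanCascade-+-≤ R zero    b _   = ≤-reflexive (sym (+-identityˡ (meanCascade R b)))
  meanCascade-+-≤ R (suc j) b j+b<1+R = begin
    meanCascade R (suc (j ℕ.+ b))         ≤⟨ meanCascade-suc-≤ R (j ℕ.+ b) j+b<1+R ⟩
    1ℚ + meanCascade R (j ℕ.+ b)          ≤⟨ +-monoʳ-≤ 1ℚ (meanCascade-+-≤ R j b (ℕ.<⇒≤ j+b<1+R)) ⟩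
    1ℚ + (fromℕ j + meanCascade R b)      ≡⟨ +-assoc 1ℚ (fromℕ j) _ ⟨
    1ℚ + fromℕ j + meanCascade R b        ≡⟨ cong (_+ meanCascade R b) (fromℕ-suc j) ⟨
    fromℕ (suc j) + meanCascade R b       ∎
    where open ≤-Reasoning

  meanCascade-≤-ratio : ∀ R K a → a ℕ.+ suc K ℕ.≤ suc R → meanCascade R a ≤ fromℕ (suc R) * recipSuc K
  meanCascade-≤-ratio R K zero K<1+R = begin
    meanCascade R zero                   ≡⟨ meanCascade-zero R ⟩
    1ℚ                                   ≡⟨ fromℕ-suc*recipSuc K ⟨
    fromℕ (suc K) * recipSuc K           ≤⟨ *-monoʳ-≤-≥0 (recipSuc-nonNeg K) (fromℕ-mono-≤ K<1+R) ⟩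
    fromℕ (suc R) * recipSuc K           ∎
    where open ≤-Reasoning
  meanCascade-≤-ratio R K (suc a) a+K<R = begin
    meanCascade R (suc a)
      ≡⟨ meanCascade-suc R a ⟩
    1ℚ + fromℕ (suc a) * (meanCascade R a * recipSuc R)
      ≤⟨ +-monoʳ-≤ 1ℚ (*-monoˡ-≤-≥0 (fromℕ-nonNeg (suc a)) (*-monoʳ-≤-≥0 (recipSuc-nonNeg R)
           (meanCascade-≤-ratio R K a (ℕ.<⇒≤ a+K<R)))) ⟩
    1ℚ + fromℕ (suc a) * (fromℕ (suc R) * recipSuc K * recipSuc R)
      ≡⟨ cong (_+_ 1ℚ) (rearrange (fromℕ (suc a)) (fromℕ (suc R)) (recipSuc K) (recipSuc R)) ⟩
    1ℚ + fromℕ (suc a) * recipSuc K * (fromℕ (suc R) * recipSuc R)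
      ≡⟨ cong₂ (λ u v → u + fromℕ (suc a) * recipSuc K * v) (sym (fromℕ-suc*recipSuc K)) (fromℕ-suc*recipSuc R) ⟩
    fromℕ (suc K) * recipSuc K + fromℕ (suc a) * recipSuc K * 1ℚ
      ≡⟨ collect (fromℕ (suc K)) (fromℕ (suc a)) (recipSuc K) ⟩
    (fromℕ (suc K) + fromℕ (suc a)) * recipSuc K
      ≡⟨ cong (_* recipSuc K) (fromℕ-+ (suc K) (suc a)) ⟨
    fromℕ (suc K ℕ.+ suc a) * recipSuc K
      ≤⟨ *-monoʳ-≤-≥0 (recipSuc-nonNeg K) (fromℕ-mono-≤ (subst (ℕ._≤ suc R) (ℕ.+-comm (suc a) (suc K)) a+K<R)) ⟩
    fromℕ (suc R) * recipSuc K           ∎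
    where
    open ≤-Reasoning
    rearrange : ∀ x y u w → x * (y * u * w) ≡ x * u * (y * w)
    rearrange = solve 4 (λ x y u w → x :* (y :* u :* w) := x :* u :* (y :* w)) refl
    collect : ∀ z x u → z * u + x * u * 1ℚ ≡ (z + x) * u
    collect = solve 3 (λ z x u → z :* u :+ x :* u :* con 1ℚ := (z :+ x) :* u) refl

  -- Split R + 1 = (K + 1) + b: the first K + 1 candidates add at most one each, the rest at most (R + 1)/(K + 1).
  meanCascade-bound : ∀ R K → suc K ℕ.≤ suc R → meanCascade R (suc R) ≤ fromℕ (suc K) + fromℕ (suc R) * recipSuc K
  meanCascade-bound R K K<1+R = begin
    meanCascade R (suc R)                                    ≡⟨ cong (meanCascade R) (ℕ.m+[n∸m]≡n K<1+R) ⟨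
    meanCascade R (suc K ℕ.+ b)                              ≤⟨ meanCascade-+-≤ R (suc K) b (ℕ.≤-reflexive (ℕ.m+[n∸m]≡n K<1+R)) ⟩
    fromℕ (suc K) + meanCascade R b                          ≤⟨ +-monoʳ-≤ (fromℕ (suc K)) (meanCascade-≤-ratio R K b (ℕ.≤-reflexive (ℕ.m∸n+n≡m K<1+R))) ⟩
    fromℕ (suc K) + fromℕ (suc R) * recipSuc K               ∎
    where
    open ≤-Reasoning
    b = suc R ℕ.∸ suc K


module SquareBounds where

  open Rationals
  open import Data.Nat.Base as ℕ using (ℕ; zero; suc; z≤n; s≤s)
  import Data.Nat.Properties as ℕ
  open import Data.Nat.Tactic.RingSolver using (solve-∀)
  open import Data.Product using (∃-syntax; _,_; _×_)
  open import Data.Rational.Base using (0ℚ; 1ℚ; _+_; _*_; _≤_; _<_; nonNegative)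
  open import Data.Rational.Properties
  open import Data.Rational.Solver using (module +-*-Solver)
  open import Relation.Binary.PropositionalEquality
  open +-*-Solver using (solve; _:+_; _:*_; _:=_)
  open import Relation.Nullary using (yes; no)

  isqrt : ∀ r → ∃[ k ] suc k ℕ.* suc k ℕ.≤ suc r × suc r ℕ.< suc (suc k) ℕ.* suc (suc k)
  isqrt zero = 0 , s≤s z≤n , s≤s (s≤s z≤n)
  isqrt (suc r) with isqrt r
  ... | k , lower , upper with suc (suc k) ℕ.* suc (suc k) ℕ.≤? suc (suc r)
  ...   | yes lower′ = suc k , lower′ , ℕ.≤-<-trans upper (ℕ.*-mono-< (ℕ.n<1+n (suc (suc k))) (ℕ.n<1+n (suc (suc k))))
  ...   | no  ¬lower′ = k , ℕ.m≤n⇒m≤1+n lower , ℕ.≰⇒> ¬lower′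

  -- With s = k + 1 and s² ≤ r < (s + 1)²: s² + r ≤ 2s(s + 1), and 4(s + 1)² < 9(s² + 1).
  square-sum-bound : ∀ k r → suc k ℕ.* suc k ℕ.≤ r → r ℕ.< suc (suc k) ℕ.* suc (suc k) →
    (suc k ℕ.* suc k ℕ.+ r) ℕ.* (suc k ℕ.* suc k ℕ.+ r) ℕ.< 9 ℕ.* suc r ℕ.* (suc k ℕ.* suc k)
  square-sum-bound k r lower upper = begin-strict
    (s² ℕ.+ r) ℕ.* (s² ℕ.+ r)                         ≤⟨ ℕ.*-mono-≤ sum≤ sum≤ ⟩
    (2 ℕ.* s ℕ.* (s ℕ.+ 1)) ℕ.* (2 ℕ.* s ℕ.* (s ℕ.+ 1)) ≡⟨ regroup k ⟩
    s² ℕ.* (4 ℕ.* (s ℕ.+ 1) ℕ.* (s ℕ.+ 1))           <⟨ ℕ.*-monoʳ-< s² (subst (4 ℕ.* (s ℕ.+ 1) ℕ.* (s ℕ.+ 1) ℕ.<_) (sym (gap k)) (ℕ.m<m+n _ (s≤s z≤n))) ⟩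
    s² ℕ.* (9 ℕ.* (s² ℕ.+ 1))                         ≤⟨ ℕ.*-monoʳ-≤ s² (ℕ.*-monoʳ-≤ 9 (subst (ℕ._≤ suc r) (ℕ.+-comm 1 s²) (s≤s lower))) ⟩
    s² ℕ.* (9 ℕ.* suc r)                              ≡⟨ ℕ.*-comm s² _ ⟩
    9 ℕ.* suc r ℕ.* s²                                ∎
    where
    open ℕ.≤-Reasoning
    s = suc k
    s² = s ℕ.* s
    expand : ∀ k → suc (suc k) ℕ.* suc (suc k) ≡ suc (suc k ℕ.* suc k ℕ.+ 2 ℕ.* suc k)
    expand = solve-∀
    double : ∀ k → suc k ℕ.* suc k ℕ.+ (suc k ℕ.* suc k ℕ.+ 2 ℕ.* suc k) ≡ 2 ℕ.* suc k ℕ.* (suc k ℕ.+ 1)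
    double = solve-∀
    regroup : ∀ k → (2 ℕ.* suc k ℕ.* (suc k ℕ.+ 1)) ℕ.* (2 ℕ.* suc k ℕ.* (suc k ℕ.+ 1))
                    ≡ (suc k ℕ.* suc k) ℕ.* (4 ℕ.* (suc k ℕ.+ 1) ℕ.* (suc k ℕ.+ 1))
    regroup = solve-∀
    gap : ∀ k → 9 ℕ.* (suc k ℕ.* suc k ℕ.+ 1) ≡ 4 ℕ.* (suc k ℕ.+ 1) ℕ.* (suc k ℕ.+ 1) ℕ.+ suc (5 ℕ.* k ℕ.* k ℕ.+ 2 ℕ.* k ℕ.+ 1)
    gap = solve-∀
    sum≤ : s² ℕ.+ r ℕ.≤ 2 ℕ.* s ℕ.* (s ℕ.+ 1)
    sum≤ = subst (s² ℕ.+ r ℕ.≤_) (double k) (ℕ.+-monoʳ-≤ s² (ℕ.s≤s⁻¹ (subst (r ℕ.<_) (expand k) upper)))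

  square-<-from-bound : ∀ X r K N → 0ℚ ≤ X → X ≤ fromℕ (suc K) + fromℕ r * recipSuc K →
    (suc K ℕ.* suc K ℕ.+ r) ℕ.* (suc K ℕ.* suc K ℕ.+ r) ℕ.< N ℕ.* (suc K ℕ.* suc K) →
    X * X < fromℕ N
  square-<-from-bound X r K N X≥0 X≤B bound = ≤-<-trans X²≤B² (*-cancelʳ-<-nonNeg (s * s) {{nonNegative (≥0*≥0⇒≥0 s≥0 s≥0)}} B²s²<Ns²)
    where
    s = fromℕ (suc K)
    s≥0 = fromℕ-nonNeg (suc K)
    B = s + fromℕ r * recipSuc K
    X²≤B² : X * X ≤ B * B
    X²≤B² = ≤-trans (*-monoˡ-≤-≥0 X≥0 X≤B) (*-monoʳ-≤-≥0 (≤-trans X≥0 X≤B) X≤B)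
    Bs : B * s ≡ fromℕ (suc K ℕ.* suc K ℕ.+ r)
    Bs = begin
      (s + fromℕ r * recipSuc K) * s          ≡⟨ distrib s (fromℕ r) (recipSuc K) ⟩
      s * s + fromℕ r * (s * recipSuc K)      ≡⟨ cong (λ x → s * s + fromℕ r * x) (fromℕ-suc*recipSuc K) ⟩
      s * s + fromℕ r * 1ℚ                    ≡⟨ cong₂ _+_ (fromℕ-* (suc K) (suc K)) (sym (*-identityʳ (fromℕ r))) ⟨
      fromℕ (suc K ℕ.* suc K) + fromℕ r       ≡⟨ fromℕ-+ (suc K ℕ.* suc K) r ⟨
      fromℕ (suc K ℕ.* suc K ℕ.+ r)           ∎
      where
      open ≡-Reasoning
      distrib : ∀ s x u → (s + x * u) * s ≡ s * s + x * (s * u)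
      distrib = solve 3 (λ s x u → (s :+ x :* u) :* s := s :* s :+ x :* (s :* u)) refl
    B²s²<Ns² : B * B * (s * s) < fromℕ N * (s * s)
    B²s²<Ns² = begin-strict
      B * B * (s * s)                          ≡⟨ square-product B s ⟩
      (B * s) * (B * s)                        ≡⟨ cong₂ _*_ Bs Bs ⟩
      fromℕ (suc K ℕ.* suc K ℕ.+ r) * fromℕ (suc K ℕ.* suc K ℕ.+ r)
                                               ≡⟨ fromℕ-* (suc K ℕ.* suc K ℕ.+ r) (suc K ℕ.* suc K ℕ.+ r) ⟨
      fromℕ ((suc K ℕ.* suc K ℕ.+ r) ℕ.* (suc K ℕ.* suc K ℕ.+ r))
                                               <⟨ fromℕ-mono-< bound ⟩
      fromℕ (N ℕ.* (suc K ℕ.* suc K))          ≡⟨ fromℕ-* N (suc K ℕ.* suc K) ⟩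
      fromℕ N * fromℕ (suc K ℕ.* suc K)        ≡⟨ cong (fromℕ N *_) (fromℕ-* (suc K) (suc K)) ⟩
      fromℕ N * (s * s)                        ∎
      where
      open ≤-Reasoning
      square-product : ∀ b s → b * b * (s * s) ≡ (b * s) * (b * s)
      square-product = solve 2 (λ b s → b :* b :* (s :* s) := (b :* s) :* (b :* s)) refl


module ThresholdProcess where

  open Counting
  open Rationals
  open Expectation
  open import Data.Bool.Base using (true; false; _∧_; _∨_)
  open import Data.Bool.Properties using (∧-conicalʳ)
  open import Data.Fin.Base using (toℕ)
  open import Data.Nat.Base as ℕ using (zero; suc; _<_)
  import Data.Nat.Properties as ℕ
  open import Data.Rational.Base as ℚ using (0ℚ)
  import Data.Rational.Properties as ℚ
  open import Data.Sum using (_⊎_; inj₁; inj₂)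
  open import Relation.Binary.PropositionalEquality
  open import Relation.Nullary.Decidable using (isYes)

  _⊆_ : ∀ {n} → VSet n → VSet n → Set
  I ⊆ B = ∀ v → I v ≡ true → B v ≡ true

  ∨-true : ∀ a {b} → a ∨ b ≡ true → a ≡ true ⊎ b ≡ true
  ∨-true true  _ = inj₁ refl
  ∨-true false b = inj₂ b

  module _ {n} (G : Adj n) (θ : Thresholds G) (B : VSet n) where

    -- θ v encodes the threshold toℕ (θ v) + 1.
    Absorbing : Set
    Absorbing = ∀ v → toℕ (θ v) < count B → B v ≡ true

    -- A vertex has at most |I| ≤ |B| infected neighbours.
    step-⊆ : Absorbing → ∀ I → I ⊆ B → step G θ I ⊆ B
    step-⊆ absorbs I I⊆B v stepped with ∨-true (I v) stepped
    ... | inj₁ Iv        = I⊆B v Iv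
    ... | inj₂ activated = absorbs v (begin-strict
      toℕ (θ v)                         <⟨ isYes-sound (toℕ (θ v) ℕ.<? infNbrs G I v) (∧-conicalʳ (isYes (1 ℕ.≤? deg G v)) _ activated) ⟩
      infNbrs G I v                     ≡⟨ countℕ≡count {n} (λ j → G v j ∧ I j) ⟩
      count (λ j → G v j ∧ I j)         ≤⟨ count-mono (λ j → ∧-conicalʳ (G v j) (I j)) ⟩
      count I                           ≤⟨ count-mono I⊆B ⟩
      count B                           ∎)
      where open ℕ.≤-Reasoning

    size-final-≤ : Absorbing → ∀ S → S ⊆ B → size (final G θ S) ℕ.≤ count B
    size-final-≤ absorbs S S⊆B = ℕ.≤-trans (ℕ.≤-reflexive (countℕ≡count (final G θ S))) (count-mono (iter-⊆ n))
      where
      iter-⊆ : ∀ k → iter k (step G θ) S ⊆ B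
      iter-⊆ zero    = S⊆B
      iter-⊆ (suc k) = step-⊆ absorbs _ (iter-⊆ k)

  σ-nonNeg : ∀ {n} (G : Adj n) S → 0ℚ ℚ.≤ σ G S
  σ-nonNeg {n} G S = subst (ℚ._≤ σ G S) (expect-const n (Range G) 0ℚ)
    (expect-mono n (Range G) λ θ → fromℕ-nonNeg (size (final G θ S)))


module CompleteGraph where

  open Counting
  open Rationals
  open Expectation
  open CascadeExpectation
  open ThresholdProcess
  open import Data.Bool.Base using (true; false; _∧_; _∨_; not)
  open import Data.Bool.Properties using (∧-identityʳ; ∨-zeroʳ)
  open import Data.Fin.Base using (Fin; toℕ)
  open import Data.Fin.Properties using (_≟_)
  open import Data.Nat.Base as ℕ using (ℕ; suc; _∸_; _<_)
  import Data.Nat.Properties as ℕ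
  import Data.Rational.Base as ℚ
  open import Relation.Binary.PropositionalEquality
  open import Relation.Nullary.Decidable using (isYes)

  Range-complete : ∀ n v → Range (complete n) v ≡ n ∸ 2
  Range-complete n v = trans (cong ℕ.pred (trans (countℕ≡count {n} _) (count-others v))) (ℕ.pred[m∸n]≡m∸[1+n] n 1)

  module _ (n : ℕ) (s : Fin n) where

    open Cascade n (Range (complete n))

    others : VSet n
    others w = not (isYes (s ≟ w))

    activates : Thresholds (complete n) → VSet n
    activates θ w = isYes (toℕ (θ w) ℕ.<? cascade others θ)

    reach : Thresholds (complete n) → VSet n
    reach θ w = isYes (s ≟ w) ∨ activates θ w

    count-reach : ∀ θ → count (reach θ) ≡ cascade others θ
    count-reach θ = begin
      count (reach θ)                                        ≡⟨ count-remove s (reach θ) ⟩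
      count (remove s (reach θ)) ℕ.+ boolToℕ (reach θ s)     ≡⟨ cong₂ (λ c b → c ℕ.+ boolToℕ (b ∨ activates θ s))
                                                                  (count-cong (λ w → drop-seed (isYes (s ≟ w)) _))
                                                                  (isYes-yes (s ≟ s) refl) ⟩
      activated others θ (cascade others θ) ℕ.+ 1            ≡⟨ ℕ.+-comm _ 1 ⟩
      suc (activated others θ (cascade others θ))            ≡⟨ cascade-fixed others θ ⟨
      cascade others θ                                       ∎
      where
      open ≡-Reasoning
      drop-seed : ∀ e x → (e ∨ x) ∧ not e ≡ not e ∧ x
      drop-seed true  x = refl
      drop-seed false x = ∧-identityʳ x

    size-final-≤-cascade : ∀ θ → size (final (complete n) θ (single s)) ℕ.≤ cascade others θ
    size-final-≤-cascade θ = subst (size (final (complete n) θ (single s)) ℕ.≤_) (count-reach θ)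
      (size-final-≤ (complete n) θ (reach θ) absorbs (single s) seed∈reach)
      where
      seed∈reach : single s ⊆ reach θ
      seed∈reach v seed = cong (_∨ activates θ v) seed
      absorbs : Absorbing (complete n) θ (reach θ)
      absorbs v below = trans (cong (isYes (s ≟ v) ∨_) (isYes-yes (toℕ (θ v) ℕ.<? cascade others θ)
        (subst (toℕ (θ v) <_) (count-reach θ) below))) (∨-zeroʳ (isYes (s ≟ v)))

    σ-≤-meanCascade : σ (complete n) (single s) ℚ.≤ meanCascade (n ∸ 2) (n ∸ 1)
    σ-≤-meanCascade = subst (σ (complete n) (single s) ℚ.≤_)
      (expect-cascade (n ∸ 2) (Range-complete n) (n ∸ 1) others (count-others s) n∸1≤1+n∸2)
      (expect-mono n (Range (complete n)) λ θ → fromℕ-mono-≤ (size-final-≤-cascade θ))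
      where
      n∸1≤1+n∸2 : n ∸ 1 ℕ.≤ suc (n ∸ 2)
      n∸1≤1+n∸2 = subst (λ k → n ∸ 1 ℕ.≤ suc k) (ℕ.∸-+-assoc n 1 1) (ℕ.m≤n+m∸n (n ∸ 1) 1)

open import Data.Nat using (ℕ; _≥_; _*_)
open import Data.Fin using (Fin)
open import Data.Integer using (+_)
open import Data.Rational using (_<_; _/_) renaming (_*_ to _*ℚ_)
open import Data.Nat.Base using (zero; suc; s≤s; z≤n)
import Data.Nat.Properties as ℕ
open import Data.Product using (_,_)
import Data.Rational.Properties as ℚ
open CascadeExpectation using (meanCascade-zero)
open MeanCascadeBounds using (meanCascade-bound)
open SquareBounds using (isqrt; square-sum-bound; square-<-from-bound)
open ThresholdProcess using (σ-nonNeg)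
open CompleteGraph using (σ-≤-meanCascade)

lemma2 : (n : ℕ) → n ≥ 1 → (s : Fin n) →
    σ (complete n) (single s) *ℚ σ (complete n) (single s) < + (9 * n) / 1
lemma2 (suc zero) _ s = square-<-from-bound (σ (complete 1) (single s)) 0 0 (9 * 1)
  (σ-nonNeg (complete 1) (single s))
  (ℚ.≤-trans (σ-≤-meanCascade 1 s) (ℚ.≤-reflexive (meanCascade-zero 0)))
  (s≤s (s≤s z≤n))
lemma2 (suc (suc n)) _ s =
  let K , lower , upper = isqrt n in
  square-<-from-bound (σ (complete (suc (suc n))) (single s)) (suc n) K (9 * suc (suc n))
    (σ-nonNeg (complete (suc (suc n))) (single s))
    (ℚ.≤-trans (σ-≤-meanCascade (suc (suc n)) s) (meanCascade-bound n K (ℕ.≤-trans (ℕ.m≤m*n (suc K) (suc K)) lower)))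
    (square-sum-bound K (suc n) lower upper)
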